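{- In an open shop system with jobs $J_1,\ldots,J_n$, any reachable state $s$ can be reached from the initial state $0$ through a sequence of at most $n+\sum_{j=1}^n|\mathcal{M}(J_j)|$ moves.
   Context: An open shop system consists of $n$ jobs $J_1,\ldots,J_n$ and $m$ machines $M_1,\ldots,M_m$. Each job $J_j$ has a set $\mathcal{M}(J_j)\subseteq\{M_1,\ldots,M_m\}$ of machines on which it must be processed, in an arbitrary order; each machine $M_i$ has a positive integer capacity $\mathrm{cap}(M_i)$ (it can hold at most that many jobs at a time). There are two artificial machines $M_0$ (where jobs wait before entering) and $M_{m+1}$ (where jobs go after leaving), both of unbounded capacity. A state $s$ specifies for every job $J_j$ a machine $M^s(J_j)\in\{M_0,\ldots,M_{m+1}\}$ on which it currently sits and a set $\mathcal{M}^s(J_j)\subseteq\mathcal{M}(J_j)\setminus\{M^s(J_j)\}$ of machines on which it still needs processing; each machine $M_i$, $1\le i\le m$, holds at most $\mathrm{cap}(M_i)$ jobs. The initial state $0$ has $M^0(J_j)=M_0$ and $\mathcal{M}^0(J_j)=\mathcal{M}(J_j)$ for all $j$. A state $t$ is a successor of $s$ (a move $s\to t$) if $t$ arises from $s$ by moving a single job $J_j$ from $M^s(J_j)$ to some machine $M\in\mathcal{M}^s(J_j)$ that currently holds fewer than $\mathrm{cap}(M)$ jobs (then $M^t(J_j)=M$, $\mathcal{M}^t(J_j)=\mathcal{M}^s(J_j)\setminus\{M\}$), or by moving a job $J_j$ with $\mathcal{M}^s(J_j)=\emptyset$ and $M^s(J_j)\neq M_{m+1}$ to $M_{m+1}$;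 all other jobs are unchanged. A state $t$ is reachable from $s$ if there is a finite sequence $s=s_0\to s_1\to\cdots\to s_k=t$ with $k\ge 0$; $t$ is reachable if it is reachable from $0$. -}

module Defs where

open import Data.Nat using (ℕ; zero; suc; _+_; _≤_; _<_)
open import Data.Fin using (Fin)
open import Data.Fin.Subset using (Subset; _∈_; _∉_; _⊆_; ∣_∣; ⊥; ⁅_⁆; _─_)
open import Data.Bool using (Bool; true; false)
open import Data.Vec using (tabulate)
open import Data.List using (map; allFin)
open import Data.Nat.ListAction using (sum)
open import Data.Unit using (⊤)
open import Data.Product using (_×_; Σ; ∃)
open import Relation.Binary.PropositionalEquality using (_≡_; _≢_)
open import Relation.Nullary using (¬_)
open import Data.Fin.Properties using (_≟_)
open import Relation.Nullary.Decidable using (⌊_⌋)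

record OpenShop (m n : ℕ) : Set where
  field
    cap     : Fin m → ℕ
    cap-pos : ∀ i → 0 < cap i
    req     : Fin n → Subset m

-- Where a job sits: M_0 (waiting), a real machine M_i, or M_{m+1} (finished).
data Loc (m : ℕ) : Set where
  M₀    : Loc m
  mach  : Fin m → Loc m
  Mₘ₊₁  : Loc m

atMachine : ∀ {m} → Loc m → Fin m → Bool
atMachine M₀ i = false
atMachine (mach k) i = ⌊ k ≟ i ⌋
atMachine Mₘ₊₁ i = false

_∉ₗ_ : ∀ {m} → Loc m → Subset m → Set
M₀ ∉ₗ S = ⊤
mach k ∉ₗ S = k ∉ S
Mₘ₊₁ ∉ₗ S = ⊤

module _ {m n : ℕ} (O : OpenShop m n) where
  open OpenShop O

  -- Raw configuration: current location M^s(J_j) and remaining set 𝓜^s(J_j).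
  record Config : Set where
    field
      pos : Fin n → Loc m
      rem : Fin n → Subset m

  open Config public

  occupants : Config → Fin m → Subset n
  occupants c i = tabulate (λ j → atMachine (pos c j) i)

  load : Config → Fin m → ℕ
  load c i = ∣ occupants c i ∣

  record State : Set where
    field
      conf     : Config
      rem⊆req  : ∀ j → rem conf j ⊆ req j
      pos∉rem  : ∀ j → pos conf j ∉ₗ rem conf j
      cap-ok   : ∀ i → load conf i ≤ cap i

  open State public

  Others : Config → Config → Fin n → Set
  Others c d j = ∀ k → k ≢ j → (pos d k ≡ pos c k) × (rem d k ≡ rem c k)

  data Move (s t : State) : Set where
    toMachine : (j : Fin n) (i : Fin m) →
      i ∈ rem (conf s) j →
      load (conf s) i < cap i →
      pos (conf t) j ≡ mach i →
      rem (conf t) j ≡ rem (conf s) j ─ ⁅ i ⁆ →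
      Others (conf s) (conf t) j →
      Move s t
    toExit : (j : Fin n) →
      rem (conf s) j ≡ ⊥ →
      pos (conf s) j ≢ Mₘ₊₁ →
      pos (conf t) j ≡ Mₘ₊₁ →
      rem (conf t) j ≡ rem (conf s) j →
      Others (conf s) (conf t) j →
      Move s t

  data Path : State → State → ℕ → Set where
    here : ∀ {s} → Path s s 0
    step : ∀ {s t u k} → Move s t → Path t u k → Path s u (suc k)

  IsInitial : State → Set
  IsInitial s = (∀ j → pos (conf s) j ≡ M₀) × (∀ j → rem (conf s) j ≡ req j)

  Reachable : State → Set
  Reachable s = Σ State λ s₀ → IsInitial s₀ × ∃ λ k → Path s₀ s k

  bound : ℕ
  bound = n + sum (map (λ j → ∣ req j ∣) (allFin n))

-- Every job J_j can be moved at most |𝓜(J_j)| times onto a machine and once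
-- to M_{m+1}, so the number of moves still available to J_j, namely
-- |𝓜^s(J_j)| plus one if J_j has not yet left, strictly decreases with every
-- move of J_j and is untouched by moves of other jobs. Summed over all jobs,
-- this potential equals the bound in the initial state and drops by at least
-- one per move, so no sequence of moves from 0 is longer than the bound.
-- The count for a job sitting on M_{m+1} is only correct because such a job
-- has nothing left to do, which is an invariant of the reachable states.
module Submission where

open import Defs
open import Data.Nat using (ℕ; suc; _+_; _≤_; _<_; z≤n; s≤s)
open import Data.Nat.Properties
  using (≤-refl; ≤-reflexive; ≤-trans; <⇒≤; m≤m+n; +-mono-≤; +-mono-<-≤; +-mono-≤-<; +-monoʳ-<; +-commutativeSemigroup; module ≤-Reasoning)
open import Algebra.Properties.CommutativeSemigroup +-commutativeSemigroup using (x∙yz≈y∙xz)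
open import Data.Fin using (Fin)
open import Data.Fin.Properties using (_≟_)
open import Data.Fin.Subset using (Subset; ⁅_⁆; _─_; ∣_∣) renaming (⊥ to ∅; _∈_ to _∈ₛ_)
open import Data.Fin.Subset.Properties using (∉⊥; p⊂q⇒∣p∣<∣q∣; x∈p⇒p-x⊂p)
open import Data.List using (List; []; _∷_; map; allFin; length)
open import Data.List.Properties using (length-tabulate; map-cong)
open import Data.List.Relation.Unary.Any using (here; there)
open import Data.List.Membership.Propositional using (_∈_)
open import Data.List.Membership.Propositional.Properties using (∈-allFin)
open import Data.Nat.ListAction using (sum)
open import Data.Product using (Σ; _×_; ∃; _,_; proj₁; proj₂)
open import Function using (_∘_)
open import Relation.Binary.PropositionalEquality using (_≡_; _≢_; refl; sym; trans; cong; cong₂; subst; module ≡-Reasoning)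
open import Relation.Nullary using (yes; no; contradiction)

module _ {a} {A : Set a} where

  sum-map-mono-≤ : {f g : A → ℕ} (xs : List A) → (∀ x → f x ≤ g x) →
    sum (map f xs) ≤ sum (map g xs)
  sum-map-mono-≤ []       f≤g = z≤n
  sum-map-mono-≤ (x ∷ xs) f≤g = +-mono-≤ (f≤g x) (sum-map-mono-≤ xs f≤g)

  sum-map-mono-< : {f g : A → ℕ} {xs : List A} {y : A} → y ∈ xs →
    (∀ x → f x ≤ g x) → f y < g y → sum (map f xs) < sum (map g xs)
  sum-map-mono-< {xs = x ∷ xs} (here refl) f≤g fy<gy = +-mono-<-≤ fy<gy (sum-map-mono-≤ xs f≤g)
  sum-map-mono-< (there y∈xs) f≤g fy<gy = +-mono-≤-< (f≤g _) (sum-map-mono-< y∈xs f≤g fy<gy)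

  sum-map-suc : (f : A → ℕ) (xs : List A) →
    sum (map (suc ∘ f) xs) ≡ length xs + sum (map f xs)
  sum-map-suc f []       = refl
  sum-map-suc f (x ∷ xs) = cong suc (begin
    f x + sum (map (suc ∘ f) xs)      ≡⟨ cong (f x +_) (sum-map-suc f xs) ⟩
    f x + (length xs + sum (map f xs)) ≡⟨ x∙yz≈y∙xz (f x) (length xs) _ ⟩
    length xs + (f x + sum (map f xs)) ∎)
    where open ≡-Reasoning

∣p─⁅x⁆∣<∣p∣ : ∀ {m} {p : Subset m} {x : Fin m} → x ∈ₛ p → ∣ p ─ ⁅ x ⁆ ∣ < ∣ p ∣
∣p─⁅x⁆∣<∣p∣ x∈p = p⊂q⇒∣p∣<∣q∣ (x∈p⇒p-x⊂p x∈p)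

pendingExit : ∀ {m} → Loc m → ℕ
pendingExit Mₘ₊₁ = 0
pendingExit _    = 1

pendingExit-≢Mₘ₊₁ : ∀ {m} {l : Loc m} → l ≢ Mₘ₊₁ → pendingExit l ≡ 1
pendingExit-≢Mₘ₊₁ {l = M₀}     _     = refl
pendingExit-≢Mₘ₊₁ {l = mach _} _     = refl
pendingExit-≢Mₘ₊₁ {l = Mₘ₊₁}  l≢Mₘ₊₁ = contradiction refl l≢Mₘ₊₁

module _ {m n : ℕ} (O : OpenShop m n) where
  open OpenShop O

  movesLeft : Config O → Fin n → ℕ
  movesLeft c j = pendingExit (pos c j) + ∣ rem c j ∣

  totalMovesLeft : Config O → ℕ
  totalMovesLeft c = sum (map (movesLeft c) (allFin n))

  ExitedJobsDone : State O → Set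
  ExitedJobsDone s = ∀ j → pos (conf s) j ≡ Mₘ₊₁ → rem (conf s) j ≡ ∅

  module _ {s t : State O} {j : Fin n} (others : Others O (conf s) (conf t) j) where

    others-movesLeft : ∀ k → k ≢ j → movesLeft (conf t) k ≡ movesLeft (conf s) k
    others-movesLeft k k≢j =
      cong₂ _+_ (cong pendingExit (proj₁ (others k k≢j))) (cong ∣_∣ (proj₂ (others k k≢j)))

    others-ExitedJobsDone : ExitedJobsDone s →
      (pos (conf t) j ≡ Mₘ₊₁ → rem (conf t) j ≡ ∅) → ExitedJobsDone t
    others-ExitedJobsDone done done-j k with k ≟ j
    ... | yes refl = done-j
    ... | no k≢j rewrite proj₁ (others k k≢j) | proj₂ (others k k≢j) = done k

    totalMovesLeft-< : movesLeft (conf t) j < movesLeft (conf s) j →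
      totalMovesLeft (conf t) < totalMovesLeft (conf s)
    totalMovesLeft-< lt = sum-map-mono-< (∈-allFin j) pointwise lt
      where
      pointwise : ∀ k → movesLeft (conf t) k ≤ movesLeft (conf s) k
      pointwise k with k ≟ j
      ... | yes refl = <⇒≤ lt
      ... | no k≢j   = ≤-reflexive (others-movesLeft k k≢j)

  unfinished-not-exited : ∀ {s} → ExitedJobsDone s → ∀ j {i} → i ∈ₛ rem (conf s) j →
    pos (conf s) j ≢ Mₘ₊₁
  unfinished-not-exited done j i∈rem exited = ∉⊥ (subst (_ ∈ₛ_) (done j exited) i∈rem)

  move-others : ∀ {s t} → Move O s t → ∃ λ j → Others O (conf s) (conf t) j
  move-others (toMachine j _ _ _ _ _ others) = j , others
  move-others (toExit j _ _ _ _ others)      = j , others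

  move-ExitedJobsDone : ∀ {s t} → ExitedJobsDone s → Move O s t → ExitedJobsDone t
  move-ExitedJobsDone {s} {t} done (toMachine j i _ _ pt _ others) =
    others-ExitedJobsDone {s} {t} others done λ ptj≡Mₘ₊₁ → contradiction (trans (sym pt) ptj≡Mₘ₊₁) λ ()
  move-ExitedJobsDone {s} {t} done (toExit j rs≡∅ _ _ rt others) =
    others-ExitedJobsDone {s} {t} others done λ _ → trans rt rs≡∅

  move-movesLeft-< : ∀ {s t} → ExitedJobsDone s → (mv : Move O s t) →
    movesLeft (conf t) (proj₁ (move-others mv)) < movesLeft (conf s) (proj₁ (move-others mv))
  move-movesLeft-< {s} done (toMachine j i i∈rem _ pt rt _)
    rewrite pt | rt | pendingExit-≢Mₘ₊₁ (unfinished-not-exited {s} done j i∈rem) = +-monoʳ-< 1 (∣p─⁅x⁆∣<∣p∣ i∈rem)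
  move-movesLeft-< done (toExit j _ not-exited pt rt _)
    rewrite pt | rt | pendingExit-≢Mₘ₊₁ not-exited = ≤-refl

  move-totalMovesLeft-< : ∀ {s t} → ExitedJobsDone s → Move O s t →
    totalMovesLeft (conf t) < totalMovesLeft (conf s)
  move-totalMovesLeft-< {s} {t} done mv = totalMovesLeft-< {s} {t} (proj₂ (move-others mv)) (move-movesLeft-< done mv)

  path-length+totalMovesLeft≤ : ∀ {s t k} → ExitedJobsDone s → Path O s t k →
    k + totalMovesLeft (conf t) ≤ totalMovesLeft (conf s)
  path-length+totalMovesLeft≤ done here = ≤-refl
  path-length+totalMovesLeft≤ done (step mv p) =
    ≤-trans (s≤s (path-length+totalMovesLeft≤ (move-ExitedJobsDone done mv) p))
            (move-totalMovesLeft-< done mv)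

  initial-ExitedJobsDone : ∀ {s} → IsInitial O s → ExitedJobsDone s
  initial-ExitedJobsDone (at-M₀ , _) j exited = contradiction (trans (sym (at-M₀ j)) exited) λ ()

  initial-totalMovesLeft : ∀ {s} → IsInitial O s → totalMovesLeft (conf s) ≡ bound O
  initial-totalMovesLeft {s} (at-M₀ , rem≡req) = begin
    sum (map (movesLeft (conf s)) (allFin n))          ≡⟨ cong sum (map-cong initial-movesLeft (allFin n)) ⟩
    sum (map (suc ∘ ∣_∣ ∘ req) (allFin n))              ≡⟨ sum-map-suc (∣_∣ ∘ req) (allFin n) ⟩
    length (allFin n) + sum (map (∣_∣ ∘ req) (allFin n)) ≡⟨ cong (_+ sum (map (∣_∣ ∘ req) (allFin n))) (length-tabulate (λ j → j)) ⟩
    bound O                                              ∎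
    where
    open ≡-Reasoning
    initial-movesLeft : ∀ j → movesLeft (conf s) j ≡ suc ∣ req j ∣
    initial-movesLeft j rewrite at-M₀ j | rem≡req j = refl

proposition2p1 : {m n : ℕ} (O : OpenShop m n) (s : State O) →
    Reachable O s →
    Σ (State O) λ s₀ → IsInitial O s₀ × ∃ λ k → k ≤ bound O × Path O s₀ s k
proposition2p1 O s (s₀ , initial , k , p) = s₀ , initial , k , k≤bound , p
  where
  open ≤-Reasoning
  k≤bound : k ≤ bound O
  k≤bound = begin
    k                                   ≤⟨ m≤m+n k _ ⟩
    k + totalMovesLeft O (conf s)     ≤⟨ path-length+totalMovesLeft≤ O (initial-ExitedJobsDone O {s₀} initial) p ⟩
    totalMovesLeft O (conf s₀)        ≡⟨ initial-totalMovesLeft O {s₀} initial ⟩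
    bound O                             ∎
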